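{- Let $i\ge0$ be an integer, $G$ an $\alpha_i$-metric graph, $x,y$ a pair of mutually distant vertices of $G$, and $z$ a middle vertex of an arbitrary shortest path connecting $x$ and $y$. Then $e(z)\le\operatorname{rad}(G)+2i+1$. Furthermore, there is a vertex $c\in I(x,y)$ with $d(x,c)=\lfloor d(x,y)/2\rfloor$ and $e(c)\le\operatorname{rad}(G)+i$.
   Context: All graphs are finite, connected, unweighted, undirected, simple; $d(u,v)$ is the shortest-path distance. $I(u,v)=\{x: d(u,x)+d(x,v)=d(u,v)\}$. A graph is $\alpha_i$-metric if for all vertices $u,w,v,x$: whenever $v\in I(u,w)$, $w\in I(v,x)$ and $vw$ is an edge, then $d(u,x)\ge d(u,v)+d(v,x)-i$. $e(v)=\max_u d(u,v)$; $\operatorname{rad}(G)=\min_v e(v)$. Vertices $x,y$ are mutually distant if $e(x)=e(y)=d(x,y)$. A middle vertex of a shortest $(x,y)$-path is a vertex $z$ of that path with $\{d(x,z),d(z,y)\}=\{\lfloor d(x,y)/2\rfloor,\lceil d(x,y)/2\rceil\}$. -}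

module Defs where

open import Data.Nat using (ℕ; zero; suc; _+_; _*_; _≤_; _⊔_; _⊓_; ⌊_/2⌋; ⌈_/2⌉)
open import Data.Fin using (Fin)
open import Data.List using (List; foldr; map)
open import Data.List using () renaming (_∷_ to _∷ₗ_)
open import Data.Vec using (allFin; toList)
open import Data.Product using (_×_; Σ; ∃; ∃-syntax)
open import Data.Sum using (_⊎_)
open import Data.Empty using (⊥)
open import Relation.Nullary using (¬_)
open import Relation.Binary.PropositionalEquality using (_≡_)

record SimpleGraph : Set₁ where
  field
    m      : ℕ
    Adj    : Fin (suc m) → Fin (suc m) → Set
    sym    : ∀ {u v} → Adj u v → Adj v u
    irrefl : ∀ {u} → ¬ Adj u u

  V : Set
  V = Fin (suc m)

  data Walk : V → V → ℕ → Set where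
    here : ∀ {u} → Walk u u 0
    step : ∀ {u w v k} → Adj u w → Walk w v k → Walk u v (suc k)

  data OnWalk (z : V) : ∀ {u v k} → Walk u v k → Set where
    at-start : ∀ {v k} (p : Walk z v k) → OnWalk z p
    later    : ∀ {u w v k} (a : Adj u w) (p : Walk w v k) → OnWalk z p → OnWalk z (step a p)

-- A connected graph together with its shortest-path distance:
-- d u v is the length of a walk from u to v, and no walk is shorter.
-- (This pins d down uniquely and forces connectivity.)
record ConnectedGraph : Set₁ where
  field
    graph : SimpleGraph
  open SimpleGraph graph public
  field
    d       : V → V → ℕ
    d-walk  : ∀ u v → Walk u v (d u v)
    d-least : ∀ u v k → Walk u v k → d u v ≤ k

  vertices : List V
  vertices = toList (allFin (suc m))

  Interval : V → V → V → Set
  Interval u v x = d u x + d x v ≡ d u v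

  ecc : V → ℕ
  ecc v = foldr (λ u r → d u v ⊔ r) 0 vertices

  rad : ℕ
  rad = foldr (λ v r → ecc v ⊓ r) (ecc Fin.zero) vertices

  MutuallyDistant : V → V → Set
  MutuallyDistant x y = (ecc x ≡ ecc y) × (ecc y ≡ d x y)

  ShortestPath : V → V → Set
  ShortestPath x y = Walk x y (d x y)

  MiddleVertex : ∀ {x y} → ShortestPath x y → V → Set
  MiddleVertex {x} {y} p z =
    OnWalk z p ×
    (((d x z ≡ ⌊ d x y /2⌋) × (d z y ≡ ⌈ d x y /2⌉)) ⊎
     ((d x z ≡ ⌈ d x y /2⌉) × (d z y ≡ ⌊ d x y /2⌋)))

  AlphaMetric : ℕ → Set
  AlphaMetric i = ∀ u w v x → Interval u w v → Interval v x w → Adj v w →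
                  d u v + d v x ≤ d u x + i

-- Let k = d(x,y) and call S_s = {c ∈ I(x,y) : d(x,c) = s} the s-th slice of the
-- interval.  In an α_i-metric graph every slice has diameter at most i+1: step two
-- vertices of S_s back to S_(s-1) and apply the α_i condition to the edges just
-- traversed.  If moreover x and y are mutually distant and s, k−s ≤ rad, then S_s
-- contains a vertex of eccentricity at most rad+i: while e(c) > rad+i, move c one
-- step towards a farthest vertex; the α_i condition together with e(x) = e(y) = k
-- keeps c inside S_s and strictly decreases Σ_u (d(u,c) ∸ (rad+i)).  As k ≤ 2 rad
-- both middle slices qualify, so a middle vertex lies within i+1 of a vertex of
-- eccentricity at most rad+i.
module Submission where

open import Defs
open import Data.Nat using (ℕ; _+_; _*_; _≤_; ⌊_/2⌋)
open import Data.Product using (_×_; ∃-syntax)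
open import Relation.Binary.PropositionalEquality using (_≡_)
open import Data.Nat using (zero; suc; _<_; _∸_; _⊔_; _⊓_; ⌈_/2⌉; z≤n; s≤s; s≤s⁻¹; _≤?_; _≟_)
open import Data.Nat.Properties
open import Data.Nat.Induction using (<-wellFounded)
open import Data.Nat.ListAction using (sum)
open import Data.Nat.Tactic.RingSolver using (solve-∀)
import Data.Fin as Fin
open import Data.List using ([]; _∷_; foldr; map)
open import Data.List.Membership.Propositional using (_∈_)
open import Data.List.Relation.Unary.Any using (here; there)
open import Data.Vec.Membership.Propositional.Properties using (∈-allFin⁺; ∈-toList⁺)
open import Data.Product using (∃; ∃₂; _,_; proj₁; proj₂)
open import Data.Sum using (_⊎_; inj₁; inj₂)
open import Induction.WellFounded using (Acc; acc)
open import Relation.Nullary using (yes; no; contradiction)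
open import Relation.Binary.PropositionalEquality
  using (refl; sym; trans; cong; cong₂; subst; subst₂)

module _ {A : Set} (f : A → ℕ) where

  ≤-foldr-⊔ : ∀ {u l} → u ∈ l → f u ≤ foldr (λ u r → f u ⊔ r) 0 l
  ≤-foldr-⊔ {l = a ∷ _} (here refl)  = m≤m⊔n (f a) _
  ≤-foldr-⊔ {l = a ∷ _} (there u∈l) = ≤-trans (≤-foldr-⊔ u∈l) (m≤n⊔m (f a) _)

  foldr-⊔-lub : ∀ {n} l → (∀ u → f u ≤ n) → foldr (λ u r → f u ⊔ r) 0 l ≤ n
  foldr-⊔-lub []      _    = z≤n
  foldr-⊔-lub (a ∷ l) f≤n = ⊔-lub (f≤n a) (foldr-⊔-lub l f≤n)

  <-foldr-⊔ : ∀ {n} l → n < foldr (λ u r → f u ⊔ r) 0 l → ∃ λ u → n < f u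
  <-foldr-⊔ (a ∷ l) n<max with ⊔-sel (f a) (foldr (λ u r → f u ⊔ r) 0 l)
  ... | inj₁ max≡fa   = a , subst (_ <_) max≡fa n<max
  ... | inj₂ max≡rest = <-foldr-⊔ l (subst (_ <_) max≡rest n<max)

  foldr-⊓-attained : ∀ a l → ∃ λ u → f u ≡ foldr (λ u r → f u ⊓ r) (f a) l
  foldr-⊓-attained a []      = a , refl
  foldr-⊓-attained a (b ∷ l) with ⊓-sel (f b) (foldr (λ u r → f u ⊓ r) (f a) l)
  ... | inj₁ min≡fb   = b , sym min≡fb
  ... | inj₂ min≡rest = let u , fu≡ = foldr-⊓-attained a l in u , trans fu≡ (sym min≡rest)

module _ {A : Set} {f g : A → ℕ} (g≤f : ∀ u → g u ≤ f u) where

  sum-map-mono-≤ : ∀ l → sum (map g l) ≤ sum (map f l)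
  sum-map-mono-≤ []      = z≤n
  sum-map-mono-≤ (a ∷ l) = +-mono-≤ (g≤f a) (sum-map-mono-≤ l)

  sum-map-mono-< : ∀ {v l} → v ∈ l → g v < f v → sum (map g l) < sum (map f l)
  sum-map-mono-< {l = _ ∷ l} (here refl)  gv<fv = +-mono-<-≤ gv<fv (sum-map-mono-≤ l)
  sum-map-mono-< {l = a ∷ _} (there v∈l) gv<fv = +-mono-≤-< (g≤f a) (sum-map-mono-< v∈l gv<fv)

+-squeeze : ∀ {m n o p} → m ≤ o → n ≤ p → o + p ≤ m + n → m ≡ o × n ≡ p
+-squeeze {m} {n} {o} {p} m≤o n≤p o+p≤m+n =
  ≤-antisym m≤o (+-cancelʳ-≤ n o m (≤-trans (+-monoʳ-≤ o n≤p) o+p≤m+n)) ,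
  ≤-antisym n≤p (+-cancelˡ-≤ m p n (≤-trans (+-monoˡ-≤ p m≤o) o+p≤m+n))

descent : ∀ {A : Set} {P Q : A → Set} (μ : A → ℕ) →
          (∀ a → P a → Q a ⊎ ∃ λ b → P b × μ b < μ a) →
          ∀ a → P a → ∃ λ b → P b × Q b
descent {P = P} {Q} μ progress a = go a (<-wellFounded (μ a))
  where
    go : ∀ a → Acc _<_ (μ a) → P a → ∃ λ b → P b × Q b
    go a (acc rs) pa with progress a pa
    ... | inj₁ qa              = a , pa , qa
    ... | inj₂ (b , pb , μb<μa) = go b (rs μb<μa) pb

module Metric (Γ : ConnectedGraph) where
  open ConnectedGraph Γ renaming (sym to Adj-sym)
  open ≤-Reasoning

  private variable
    k n s t : ℕ
    a b c q u v w x y z : V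

  snoc : Walk u v n → Adj v w → Walk u w (suc n)
  snoc here       e′ = step e′ here
  snoc (step e p) e′ = step e (snoc p e′)

  reverse : Walk u v n → Walk v u n
  reverse here       = here
  reverse (step e p) = snoc (reverse p) (Adj-sym e)

  _++ʷ_ : Walk u v k → Walk v w n → Walk u w (k + n)
  here     ++ʷ q = q
  step e p ++ʷ q = step e (p ++ʷ q)

  Walk₀⇒≡ : Walk u v 0 → u ≡ v
  Walk₀⇒≡ here = refl

  d-triangle : ∀ u v w → d u w ≤ d u v + d v w
  d-triangle u v w = d-least u w _ (d-walk u v ++ʷ d-walk v w)

  d-sym : ∀ u v → d u v ≡ d v u
  d-sym u v = ≤-antisym (d-least u v _ (reverse (d-walk v u)))
                        (d-least v u _ (reverse (d-walk u v)))

  d-refl : ∀ u → d u u ≡ 0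
  d-refl u = n≤0⇒n≡0 (d-least u u 0 here)

  d≡0⇒≡ : d u v ≡ 0 → u ≡ v
  d≡0⇒≡ {u} {v} uv≡0 = Walk₀⇒≡ (subst (Walk u v) uv≡0 (d-walk u v))

  Adj⇒d≡1 : Adj u v → d u v ≡ 1
  Adj⇒d≡1 {u} {v} e = ≤-antisym (d-least u v 1 (step e here))
    (n≢0⇒n>0 λ uv≡0 → irrefl (subst (Adj u) (sym (d≡0⇒≡ uv≡0)) e))

  d-Adj-≤ : ∀ t → Adj u w → d t w ≤ suc (d t u)
  d-Adj-≤ {u} {w} t e = d-least t w _ (snoc (d-walk t u) e)

  d-Adj-cases : ∀ t → Adj u w → d t w ≡ suc (d t u) ⊎ d t w ≤ d t u
  d-Adj-cases {u} {w} t e with d t w ≟ suc (d t u)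
  ... | yes tw≡ = inj₁ tw≡
  ... | no  tw≢ = inj₂ (s≤s⁻¹ (≤∧≢⇒< (d-Adj-≤ t e) tw≢))

  geodesic-step : 0 < d u v → ∃ λ w → Adj u w × d u v ≡ suc (d w v)
  geodesic-step {u} {v} 0<uv with d u v in uv≡ | d-walk u v
  ... | suc n | step {w = w} e p = w , e , cong suc (≤-antisym n≤wv (d-least w v n p))
    where
      n≤wv : n ≤ d w v
      n≤wv = s≤s⁻¹ (begin
        suc n           ≡⟨ uv≡ ⟨
        d u v           ≤⟨ d-triangle u w v ⟩
        d u w + d w v   ≡⟨ cong (_+ d w v) (Adj⇒d≡1 e) ⟩
        suc (d w v)     ∎)

  ∈-vertices : ∀ v → v ∈ vertices
  ∈-vertices v = ∈-toList⁺ (∈-allFin⁺ v)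

  d≤ecc : ∀ u v → d u v ≤ ecc v
  d≤ecc u v = ≤-foldr-⊔ (λ u → d u v) (∈-vertices u)

  ecc-lub : ∀ v → (∀ u → d u v ≤ n) → ecc v ≤ n
  ecc-lub v = foldr-⊔-lub (λ u → d u v) vertices

  ecc-≤-ecc+d : ∀ z c → ecc z ≤ ecc c + d c z
  ecc-≤-ecc+d z c = ecc-lub z λ u →
    ≤-trans (d-triangle u c z) (+-monoˡ-≤ (d c z) (d≤ecc u c))

  step-toward-far-vertex : n < ecc c → ∃₂ λ v q → Adj c q × n < d c v × d c v ≡ suc (d q v)
  step-toward-far-vertex {c = c} n<ecc with <-foldr-⊔ (λ u → d u c) vertices n<ecc
  ... | v , n<vc with subst (_ <_) (d-sym v c) n<vc
  ... | n<cv with geodesic-step (≤-trans (s≤s z≤n) n<cv)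
  ... | q , e , cv≡ = v , q , e , n<cv , cv≡

  centre : ∃ λ w → ecc w ≡ rad
  centre = foldr-⊓-attained ecc Fin.zero vertices

  d≤rad+rad : ∀ u v → d u v ≤ rad + rad
  d≤rad+rad u v with centre
  ... | w , ecc-w≡rad = begin
    d u v          ≤⟨ d-triangle u w v ⟩
    d u w + d w v  ≤⟨ +-mono-≤ (d≤ecc u w) (subst (_≤ ecc w) (d-sym v w) (d≤ecc v w)) ⟩
    ecc w + ecc w  ≡⟨ cong₂ _+_ ecc-w≡rad ecc-w≡rad ⟩
    rad + rad      ∎

  ⌈d/2⌉≤rad : ∀ u v → ⌈ d u v /2⌉ ≤ rad
  ⌈d/2⌉≤rad u v = ≤-trans (⌈n/2⌉-mono (d≤rad+rad u v)) (≤-reflexive (sym (n≡⌈n+n/2⌉ rad)))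

  Interval-sym : Interval x y a → Interval y x a
  Interval-sym {x} {y} {a} a∈I = begin-equality
    d y a + d a x  ≡⟨ +-comm (d y a) (d a x) ⟩
    d a x + d y a  ≡⟨ cong₂ _+_ (d-sym a x) (d-sym y a) ⟩
    d x a + d a y  ≡⟨ a∈I ⟩
    d x y          ≡⟨ d-sym x y ⟩
    d y x          ∎

  Slice : V → V → ℕ → V → Set
  Slice x y s a = Interval x y a × d x a ≡ s

  slice-d-right : Slice x y s a → s + t ≡ d x y → d a y ≡ t
  slice-d-right {x} {y} {s} {a} {t} (a∈I , xa≡s) s+t≡ = +-cancelˡ-≡ s _ _ (begin-equality
    s + d a y      ≡⟨ cong (_+ d a y) xa≡s ⟨
    d x a + d a y  ≡⟨ a∈I ⟩
    d x y          ≡⟨ s+t≡ ⟨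
    s + t          ∎)

  slice-d-≡ : Slice x y s a → Slice x y s b → d a y ≡ d b y
  slice-d-≡ sa (b∈I , xb≡s) = slice-d-right sa (trans (cong (_+ _) (sym xb≡s)) b∈I)

  slice-neighbour : Slice x y s c → Adj c q → d x q ≤ d x c → d y q ≤ d y c → Slice x y s q
  slice-neighbour {x} {y} {s} {c} {q} (c∈I , xc≡s) e xq≤ yq≤ = q∈I , trans xq≡xc xc≡s
    where
      qy≤cy : d q y ≤ d c y
      qy≤cy = subst₂ _≤_ (d-sym y q) (d-sym y c) yq≤
      squeeze : d x q ≡ d x c × d q y ≡ d c y
      squeeze = +-squeeze xq≤ qy≤cy (subst (_≤ d x q + d q y) (sym c∈I) (d-triangle x q y))
      xq≡xc = proj₁ squeeze
      q∈I : Interval x y q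
      q∈I = trans (cong₂ _+_ xq≡xc (proj₂ squeeze)) c∈I

  slice-predecessor : Slice x y (suc n) a →
                      ∃ λ a′ → Adj a′ a × Slice x y n a′ × d a′ y ≡ suc (d a y)
  slice-predecessor {x} {y} {n} {a} (a∈I , xa≡)
    with geodesic-step {a} {x} (subst (0 <_) (trans (sym xa≡) (d-sym x a)) (s≤s z≤n))
  ... | a′ , e , ax≡ = a′ , Adj-sym e , (a′∈I , xa′≡n) , a′y≡
    where
      xa′≡n : d x a′ ≡ n
      xa′≡n = suc-injective (trans (cong suc (d-sym x a′)) (trans (sym ax≡) (trans (d-sym a x) xa≡)))
      n+ay+1≡xy : n + suc (d a y) ≡ d x y
      n+ay+1≡xy = trans (+-suc n (d a y)) (trans (cong (_+ d a y) (sym xa≡)) a∈I)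
      a′y≡ : d a′ y ≡ suc (d a y)
      a′y≡ = ≤-antisym (subst₂ (λ p r → p ≤ suc r) (d-sym y a′) (d-sym y a) (d-Adj-≤ y e))
        (+-cancelˡ-≤ n _ _ (begin
          n + suc (d a y)  ≡⟨ n+ay+1≡xy ⟩
          d x y            ≤⟨ d-triangle x a′ y ⟩
          d x a′ + d a′ y  ≡⟨ cong (_+ d a′ y) xa′≡n ⟩
          n + d a′ y       ∎))
      a′∈I : Interval x y a′
      a′∈I = trans (cong₂ _+_ xa′≡n a′y≡) n+ay+1≡xy

  slice-nonempty : s ≤ d x y → ∃ (Slice x y s)
  slice-nonempty {s} {x} {y} s≤xy = go (d x y ∸ s) y (y∈I , sym (m∸n+n≡m s≤xy))
    where
      go : ∀ n a → Slice x y (n + s) a → ∃ (Slice x y s)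
      go zero    a sa = a , sa
      go (suc n) a sa with slice-predecessor sa
      ... | a′ , _ , sa′ , _ = go n a′ sa′
      y∈I : Interval x y y
      y∈I = trans (cong (d x y +_) (d-refl y)) (+-identityʳ (d x y))

  middle-vertex-bounds : (p : ShortestPath x y) → MiddleVertex p z →
                         Interval x y z × d x z ≤ ⌈ d x y /2⌉ × d z y ≤ ⌈ d x y /2⌉
  middle-vertex-bounds {x} {y} _ (_ , inj₁ (xz≡ , zy≡)) =
    trans (cong₂ _+_ xz≡ zy≡) (⌊n/2⌋+⌈n/2⌉≡n (d x y)) ,
    ≤-trans (≤-reflexive xz≡) (⌊n/2⌋≤⌈n/2⌉ (d x y)) , ≤-reflexive zy≡
  middle-vertex-bounds {x} {y} _ (_ , inj₂ (xz≡ , zy≡)) =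
    trans (cong₂ _+_ xz≡ zy≡) (trans (+-comm ⌈ d x y /2⌉ ⌊ d x y /2⌋) (⌊n/2⌋+⌈n/2⌉≡n (d x y))) ,
    ≤-reflexive xz≡ , ≤-trans (≤-reflexive zy≡) (⌊n/2⌋≤⌈n/2⌉ (d x y))

module AlphaMetricGraph (Γ : ConnectedGraph) (i : ℕ) (α : ConnectedGraph.AlphaMetric Γ i) where
  open ConnectedGraph Γ renaming (sym to Adj-sym)
  open Metric Γ
  open ≤-Reasoning

  private variable
    r s : ℕ
    a b c q t u v w x y z : V

  α-step : Adj v w → d u w ≡ suc (d u v) → d v t ≡ suc (d w t) → d u v + d v t ≤ d u t + i
  α-step {v} {w} {u} {t} e uw≡ vt≡ = α u w v t u-v-w v-w-t e
    where
      u-v-w : Interval u w v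
      u-v-w = trans (cong (d u v +_) (Adj⇒d≡1 e)) (trans (+-comm (d u v) 1) (sym uw≡))
      v-w-t : Interval v t w
      v-w-t = trans (cong (_+ d w t) (Adj⇒d≡1 e)) (sym vt≡)

  step-toward-stays-within : Adj v w → d v t ≡ suc (d w t) → d u t ≤ d v t →
                             d u v ≤ suc i → d u w ≤ suc i
  step-toward-stays-within {v} {w} {t} {u} e vt≡ ut≤vt uv≤ with d-Adj-cases u e
  ... | inj₂ uw≤uv = ≤-trans uw≤uv uv≤
  ... | inj₁ uw≡ = subst (_≤ suc i) (sym uw≡) (s≤s (+-cancelʳ-≤ (d v t) (d u v) i (begin
    d u v + d v t  ≤⟨ α-step e uw≡ vt≡ ⟩
    d u t + i      ≤⟨ +-monoˡ-≤ i ut≤vt ⟩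
    d v t + i      ≡⟨ +-comm (d v t) i ⟩
    i + d v t      ∎)))

  slice-diameter : Slice x y s a → Slice x y s b → d a b ≤ suc i
  slice-diameter {s = zero} (_ , xa≡0) (_ , xb≡0) with d≡0⇒≡ xa≡0 | d≡0⇒≡ xb≡0
  ... | refl | refl = subst (_≤ suc i) (sym (d-refl _)) z≤n
  slice-diameter {x} {y} {suc s} {a} {b} sa sb
    with slice-predecessor sa | slice-predecessor sb
  ... | a′ , a′a , sa′ , a′y≡ | b′ , b′b , sb′ , b′y≡ =
    subst (_≤ suc i) (d-sym b a) (step-toward-stays-within a′a a′y≡ by≤a′y ba′≤)
    where
      a′b≤ : d a′ b ≤ suc i
      a′b≤ = step-toward-stays-within b′b b′y≡ (≤-reflexive (slice-d-≡ sa′ sb′))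
                                      (slice-diameter sa′ sb′)
      ba′≤ : d b a′ ≤ suc i
      ba′≤ = subst (_≤ suc i) (d-sym a′ b) a′b≤
      by≤a′y : d b y ≤ d a′ y
      by≤a′y = begin
        d b y        ≡⟨ slice-d-≡ sb sa ⟩
        d a y        ≤⟨ n≤1+n (d a y) ⟩
        suc (d a y)  ≡⟨ a′y≡ ⟨
        d a′ y       ∎

  step-away-bound : Adj c q → d x q ≡ suc (d x c) → d c v ≡ suc (d q v) →
                    d x v ≤ d x c + r → d c v ≤ r + i
  step-away-bound {c} {q} {x} {v} {r} e xq≡ cv≡ xv≤ = +-cancelˡ-≤ (d x c) (d c v) (r + i) (begin
    d x c + d c v    ≤⟨ α-step e xq≡ cv≡ ⟩
    d x v + i        ≤⟨ +-monoˡ-≤ i xv≤ ⟩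
    d x c + r + i    ≡⟨ +-assoc (d x c) r i ⟩
    d x c + (r + i)  ∎)

  excess : V → ℕ
  excess c = sum (map (λ u → d u c ∸ (rad + i)) vertices)

  excess-decreases : Adj c q → d c v ≡ suc (d q v) → rad + i < d c v → excess q < excess c
  excess-decreases {c} {q} {v} e cv≡ far =
    sum-map-mono-< pointwise (∈-vertices v) (∸-monoˡ-< qv<cv near)
    where
      near : rad + i ≤ d v q
      near = subst (rad + i ≤_) (d-sym q v) (s≤s⁻¹ (subst (rad + i <_) cv≡ far))
      qv<cv : d v q < d v c
      qv<cv = subst₂ _<_ (d-sym q v) (d-sym c v) (subst (d q v <_) (sym cv≡) ≤-refl)
      pointwise : ∀ u → d u q ∸ (rad + i) ≤ d u c ∸ (rad + i)
      pointwise u with d-Adj-cases u e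
      ... | inj₂ uq≤uc = ∸-monoˡ-≤ (rad + i) uq≤uc
      ... | inj₁ uq≡ = subst (_≤ d u c ∸ (rad + i)) (sym (m≤n⇒m∸n≡0 uq≤)) z≤n
        where
          uc<rad : d u c < rad
          uc<rad = +-cancelʳ-< (rad + i) (d u c) rad (begin-strict
            d u c + (rad + i)  <⟨ +-monoʳ-< (d u c) far ⟩
            d u c + d c v      ≤⟨ α-step e uq≡ cv≡ ⟩
            d u v + i          ≤⟨ +-monoˡ-≤ i (d≤rad+rad u v) ⟩
            rad + rad + i      ≡⟨ +-assoc rad rad i ⟩
            rad + (rad + i)    ∎)
          uq≤ : d u q ≤ rad + i
          uq≤ = ≤-trans (subst (_≤ rad) (sym uq≡) uc<rad) (m≤m+n rad i)

  module _ {x y} (distant : MutuallyDistant x y) where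

    slice-descent-step : Slice x y s c → s ≤ rad → d c y ≤ rad → rad + i < ecc c →
                         ∃ λ q → Slice x y s q × excess q < excess c
    slice-descent-step {s} {c} sc@(c∈I , xc≡s) s≤rad cy≤rad big with step-toward-far-vertex big
    ... | v , q , e , far , cv≡ =
      q , slice-neighbour sc e (q-no-farther x-bound cy≤rad) (q-no-farther y-bound cx≤rad) ,
      excess-decreases e cv≡ far
      where
        q-no-farther : ∀ {z r} → d z v ≤ d z c + r → r ≤ rad → d z q ≤ d z c
        q-no-farther {z} zv≤ r≤rad with d-Adj-cases z e
        ... | inj₂ zq≤zc = zq≤zc
        ... | inj₁ zq≡ =
          contradiction (≤-trans (step-away-bound e zq≡ cv≡ zv≤) (+-monoˡ-≤ i r≤rad)) (<⇒≱ far)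
        x-bound : d x v ≤ d x c + d c y
        x-bound = begin
          d x v          ≡⟨ d-sym x v ⟩
          d v x          ≤⟨ d≤ecc v x ⟩
          ecc x          ≡⟨ trans (proj₁ distant) (proj₂ distant) ⟩
          d x y          ≡⟨ c∈I ⟨
          d x c + d c y  ∎
        y-bound : d y v ≤ d y c + d c x
        y-bound = begin
          d y v          ≡⟨ d-sym y v ⟩
          d v y          ≤⟨ d≤ecc v y ⟩
          ecc y          ≡⟨ trans (proj₂ distant) (d-sym x y) ⟩
          d y x          ≡⟨ Interval-sym c∈I ⟨
          d y c + d c x  ∎
        cx≤rad : d c x ≤ rad
        cx≤rad = subst (_≤ rad) (trans (sym xc≡s) (d-sym x c)) s≤rad

    slice-central-vertex : Slice x y s a → s ≤ rad → d a y ≤ rad →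
                           ∃ λ c → Slice x y s c × ecc c ≤ rad + i
    slice-central-vertex {s} {a} sa s≤rad ay≤rad = descent excess progress a sa
      where
        progress : ∀ c → Slice x y s c → ecc c ≤ rad + i ⊎ ∃ λ q → Slice x y s q × excess q < excess c
        progress c sc with ecc c ≤? rad + i
        ... | yes small = inj₁ small
        ... | no  big   = inj₂ (slice-descent-step sc s≤rad
                                  (subst (_≤ rad) (slice-d-≡ sa sc) ay≤rad) (≰⇒> big))

    middle-vertex-ecc : (p : ShortestPath x y) → MiddleVertex p z → ecc z ≤ rad + 2 * i + 1
    middle-vertex-ecc {z} p mid with middle-vertex-bounds p mid
    ... | z∈I , xz≤ , zy≤ with slice-central-vertex (z∈I , refl)
                                 (≤-trans xz≤ (⌈d/2⌉≤rad x y)) (≤-trans zy≤ (⌈d/2⌉≤rad x y))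
    ... | c , sc , ecc-c≤ = begin
      ecc z            ≤⟨ ecc-≤-ecc+d z c ⟩
      ecc c + d c z    ≤⟨ +-mono-≤ ecc-c≤ (slice-diameter sc (z∈I , refl)) ⟩
      rad + i + suc i  ≡⟨ regroup rad i ⟩
      rad + 2 * i + 1  ∎
      where
        regroup : ∀ r i → r + i + suc i ≡ r + 2 * i + 1
        regroup = solve-∀

    central-vertex-at-half : ∃[ c ] (Interval x y c × d x c ≡ ⌊ d x y /2⌋ × ecc c ≤ rad + i)
    central-vertex-at-half with slice-nonempty (⌊n/2⌋≤n (d x y))
    ... | a , sa with slice-central-vertex sa (≤-trans (⌊n/2⌋≤⌈n/2⌉ (d x y)) (⌈d/2⌉≤rad x y))
                        (≤-trans (≤-reflexive (slice-d-right sa (⌊n/2⌋+⌈n/2⌉≡n (d x y)))) (⌈d/2⌉≤rad x y))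
    ... | c , (c∈I , xc≡) , ecc-c≤ = c , c∈I , xc≡ , ecc-c≤

lemma5 : (i : ℕ) (G : ConnectedGraph) → ConnectedGraph.AlphaMetric G i →
         ∀ x y → ConnectedGraph.MutuallyDistant G x y →
         (p : ConnectedGraph.ShortestPath G x y) → ∀ z → ConnectedGraph.MiddleVertex G p z →
         (ConnectedGraph.ecc G z ≤ ConnectedGraph.rad G + 2 * i + 1)
         × (∃[ c ] (ConnectedGraph.Interval G x y c
                    × (ConnectedGraph.d G x c ≡ ⌊ ConnectedGraph.d G x y /2⌋)
                    × (ConnectedGraph.ecc G c ≤ ConnectedGraph.rad G + i)))
lemma5 i G α x y distant p z mid = middle-vertex-ecc distant p mid , central-vertex-at-half distant
  where open AlphaMetricGraph G i α
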